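{- Let $N=\{n!:n\geqslant 1\}=\{1,2,6,24,\ldots\}$. For all integers $a,b\geqslant 6$, we have $p_N(a)\,p_N(b)>p_N(a+b)$.
   Context: $p_N(n)$ denotes the number of partitions of $n$ all of whose parts are factorials $k!$ with $k\geqslant1$. -}

module Defs where

open import Data.Nat using (ℕ; zero; suc; _+_; _*_; _∸_; _≤?_; _!)
open import Relation.Nullary using (yes; no)

-- countMult d m f : sum of f (m ∸ j * d) over all j ≥ 0 with j * d ≤ m,
-- for a step d = suc d' ≥ 1 (fuel = m + 1 suffices since d ≥ 1).
sumSteps : (d' : ℕ) → (fuel m : ℕ) → (ℕ → ℕ) → ℕ
sumSteps d' zero m f = 0
sumSteps d' (suc fuel) m f with suc d' ≤? m
... | yes _ = f m + sumSteps d' fuel (m ∸ suc d') f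
... | no  _ = f m

-- factorial of suc k is suc of something (to expose nonzero step)
fact-pred : ℕ → ℕ
fact-pred k = (suc k) ! ∸ 1

-- P k n : number of partitions of n all of whose parts lie in {1!, 2!, …, k!}
-- (i.e. multisets of such parts summing to n). Recursion on k: choose the
-- multiplicity j of the part k! (j * k! ≤ n), and partition the rest using
-- parts from {1!, …, (k-1)!}.
P : ℕ → ℕ → ℕ
P zero zero = 1
P zero (suc n) = 0
P (suc k) n = sumSteps (fact-pred k) (suc n) n (P k)

-- p_N n : number of partitions of n into parts from N = {k! : k ≥ 1}.
-- Any part k! of a partition of n satisfies k ≤ k! ≤ n, so parts from
-- {1!, …, n!} already give all partitions of n.
pN : ℕ → ℕ
pN n = P n n

-- Every partition into factorials consists of some parts 1 and twice a partition
-- into the parts k!/2 (k ≥ 2), so p_N(n) = Q(⌊n/2⌋) where Q(m) = q(0) + ⋯ + q(m)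
-- and q counts partitions into 1, 3, 12, 60, …  Splitting off the parts 1 of
-- these partitions in the same way gives q(2x+3) ≤ q(2x+1) + q(x+1), hence
-- q(2x+1) ≤ Q(x), strictly for x ≥ 2. For α = ⌊a/2⌋ ≤ β = ⌊b/2⌋ the
-- monotonicity of q then gives
--   Q(α+β+1) ≤ Q(β) + (α+1) q(2β+1) < (α+2) Q(β) ≤ Q(α) Q(β),
-- the last step because q ≥ 1 and q(3) = 2, so Q(α) ≥ α+2 once α ≥ 3.
module Submission where

open import Data.Nat
  using (ℕ; zero; suc; _+_; _*_; _∸_; _≤_; _<_; _>_; _≤?_; _!; z≤n; s≤s; z<s;
         NonZero; >-nonZero⁻¹)
open import Data.Nat.DivMod
open import Data.Nat.Induction using (<-rec)
open import Data.Nat.Properties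
open import Algebra.Properties.CommutativeSemigroup +-commutativeSemigroup
  using () renaming (interchange to +-interchange)
open import Data.Sum using (inj₁; inj₂)
open import Function using (_∘_)
open import Relation.Binary.Core using (_Preserves_⟶_)
open import Relation.Binary.PropositionalEquality
open import Relation.Nullary using (yes; no; contradiction)

open import Defs

-- stepSum d f m is the sum of f (m ∸ j * d) over j * d ≤ m, so that
-- P (suc k) is stepSum (suc k !) (P k) by definition.
stepSum : ℕ → (ℕ → ℕ) → ℕ → ℕ
stepSum d f m = sumSteps (d ∸ 1) (suc m) m f

sumSteps-fuel : ∀ d′ f {m fuel fuel′} → m < fuel → m < fuel′ →
                sumSteps d′ fuel m f ≡ sumSteps d′ fuel′ m f
sumSteps-fuel d′ f {m} {suc _} {suc _} (s≤s m≤fuel) (s≤s m≤fuel′) with suc d′ ≤? m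
... | yes d≤m =
  cong (f m +_) (sumSteps-fuel d′ f (<-≤-trans m∸d<m m≤fuel) (<-≤-trans m∸d<m m≤fuel′))
  where
  m∸d<m : m ∸ suc d′ < m
  m∸d<m = ∸-monoʳ-< z<s d≤m
... | no _    = refl

sumSteps-cong : ∀ d′ {f g} → f ≗ g → ∀ fuel m →
                sumSteps d′ fuel m f ≡ sumSteps d′ fuel m g
sumSteps-cong d′ f≗g zero       m = refl
sumSteps-cong d′ f≗g (suc fuel) m with suc d′ ≤? m
... | yes _ = cong₂ _+_ (f≗g m) (sumSteps-cong d′ f≗g fuel (m ∸ suc d′))
... | no _  = f≗g m

stepSum-≥ : ∀ {d} .{{_ : NonZero d}} f {m} → d ≤ m →
            stepSum d f m ≡ f m + stepSum d f (m ∸ d)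
stepSum-≥ {suc d′} f {m} d≤m with suc d′ ≤? m
... | yes _   = cong (f m +_) (sumSteps-fuel d′ f (∸-monoʳ-< z<s d≤m) ≤-refl)
... | no d≰m = contradiction d≤m d≰m

stepSum-< : ∀ {d} f {m} → m < d → stepSum d f m ≡ f m
stepSum-< {suc d′} f {m} m<d with suc d′ ≤? m
... | yes d≤m = contradiction d≤m (<⇒≱ m<d)
... | no _    = refl

partialSum : (ℕ → ℕ) → ℕ → ℕ
partialSum f zero    = f zero
partialSum f (suc n) = partialSum f n + f (suc n)

partialSum-cong : ∀ {f g} N → (∀ {v} → v ≤ N → f v ≡ g v) →
                  partialSum f N ≡ partialSum g N
partialSum-cong zero    f≡g = f≡g z≤n
partialSum-cong (suc N) f≡g =
  cong₂ _+_ (partialSum-cong N (f≡g ∘ m≤n⇒m≤1+n)) (f≡g ≤-refl)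

partialSum-mono : ∀ f → partialSum f Preserves _≤_ ⟶ _≤_
partialSum-mono f {y = zero}  z≤n = ≤-refl
partialSum-mono f {y = suc n} m≤1+n with m≤n⇒m<n∨m≡n m≤1+n
... | inj₁ (s≤s m≤n) = ≤-trans (partialSum-mono f m≤n) (m≤m+n _ _)
... | inj₂ refl      = ≤-refl

partialSum-≤-suc : ∀ f {u v} → v ≤ suc u → partialSum f v ≤ partialSum f u + f v
partialSum-≤-suc f v≤1+u with m≤n⇒m<n∨m≡n v≤1+u
... | inj₁ (s≤s v≤u) = ≤-trans (partialSum-mono f v≤u) (m≤m+n _ _)
... | inj₂ refl      = ≤-refl

partialSum-+-≤ : ∀ {q} → q Preserves _≤_ ⟶ _≤_ → ∀ k β →
                 partialSum q (k + β) ≤ partialSum q β + k * q (k + β)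
partialSum-+-≤ {q} q-mono zero    β = m≤m+n (partialSum q β) 0
partialSum-+-≤ {q} q-mono (suc k) β = begin
  partialSum q (k + β) + Y           ≤⟨ +-monoˡ-≤ Y (partialSum-+-≤ q-mono k β) ⟩
  partialSum q β + k * q (k + β) + Y ≤⟨ +-monoˡ-≤ Y (+-monoʳ-≤ (partialSum q β) (*-monoʳ-≤ k qk+β≤Y)) ⟩
  partialSum q β + k * Y + Y         ≡⟨ +-assoc (partialSum q β) (k * Y) Y ⟩
  partialSum q β + (k * Y + Y)       ≡⟨ cong (partialSum q β +_) (+-comm (k * Y) Y) ⟩
  partialSum q β + suc k * Y         ∎
  where
  open ≤-Reasoning
  Y : ℕ
  Y = q (suc (k + β))
  qk+β≤Y : q (k + β) ≤ Y
  qk+β≤Y = q-mono (n≤1+n (k + β))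

partialSum-stepSum : ∀ {M} .{{_ : NonZero M}} B {N} → M ≤ N →
  partialSum (stepSum M B) N ≡ partialSum B N + partialSum (stepSum M B) (N ∸ M)
partialSum-stepSum {M@(suc m)} B {N} M≤N =
  subst (λ n → partialSum g n ≡ partialSum B n + partialSum g (N ∸ M))
        (m∸n+n≡m M≤N) (shifted (N ∸ M))
  where
  open ≡-Reasoning
  g : ℕ → ℕ
  g = stepSum M B
  shifted : ∀ k → partialSum g (k + M) ≡ partialSum B (k + M) + partialSum g k
  shifted zero = begin
    partialSum g m + g M                   ≡⟨ cong₂ _+_ (partialSum-cong m (stepSum-< B ∘ s≤s))
                                                        (stepSum-≥ B ≤-refl) ⟩
    partialSum B m + (B M + g (m ∸ m))     ≡⟨ cong (λ v → partialSum B m + (B M + g v)) (n∸n≡0 m) ⟩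
    partialSum B m + (B M + g 0)           ≡⟨ +-assoc (partialSum B m) (B M) (g 0) ⟨
    partialSum B m + B M + g 0             ∎
  shifted (suc k) = begin
    partialSum g (k + M) + g (suc k + M)
      ≡⟨ cong₂ _+_ (shifted k) (stepSum-≥ B (m≤n+m M (suc k))) ⟩
    (partialSum B (k + M) + partialSum g k) + (B (suc k + M) + g (suc k + M ∸ M))
      ≡⟨ cong (λ v → (partialSum B (k + M) + partialSum g k) + (B (suc k + M) + g v))
              (m+n∸n≡m (suc k) M) ⟩
    (partialSum B (k + M) + partialSum g k) + (B (suc k + M) + g (suc k))
      ≡⟨ +-interchange (partialSum B (k + M)) (partialSum g k) _ _ ⟩
    partialSum B (suc k + M) + partialSum g (suc k)
      ∎

m<[1+m/n]*n : ∀ m n .{{_ : NonZero n}} → m < suc (m / n) * n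
m<[1+m/n]*n m n =
  subst (_< n + m / n * n) (sym (m≡m%n+[m/n]*n m n)) (+-monoˡ-< (m / n * n) (m%n<n m n))

[1+m+n]/o≤1+m/o+n/o : ∀ m n o .{{_ : NonZero o}} → suc (m + n) / o ≤ suc (m / o + n / o)
[1+m+n]/o≤1+m/o+n/o m n o = ≤-pred (m<n*o⇒m/o<n (begin
  suc (suc (m + n))               ≡⟨ cong suc (+-suc m n) ⟨
  suc m + suc n                   ≤⟨ +-mono-≤ (m<[1+m/n]*n m o) (m<[1+m/n]*n n o) ⟩
  suc (m / o) * o + suc (n / o) * o ≡⟨ *-distribʳ-+ o (suc (m / o)) (suc (n / o)) ⟨
  (suc (m / o) + suc (n / o)) * o ≡⟨ cong (λ k → suc k * o) (+-suc (m / o) (n / o)) ⟩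
  suc (suc (m / o + n / o)) * o   ∎))
  where open ≤-Reasoning

[2+m]/n≤1+m/n : ∀ m n .{{_ : NonZero n}} → 2 ≤ n → (2 + m) / n ≤ suc (m / n)
[2+m]/n≤1+m/n m n 2≤n = begin
  (2 + m) / n       ≤⟨ /-monoˡ-≤ n (+-monoˡ-≤ m 2≤n) ⟩
  (n + m) / n       ≡⟨ m/n≡1+[m∸n]/n (m≤m+n n m) ⟩
  suc ((n + m ∸ n) / n) ≡⟨ cong (λ k → suc (k / n)) (m+n∸m≡n n m) ⟩
  suc (m / n)       ∎
  where open ≤-Reasoning

coarsen : ∀ M c .{{_ : NonZero M}} .{{_ : NonZero c}} B n →
          stepSum (M * c) (λ m → partialSum B (m / c)) n ≡ partialSum (stepSum M B) (n / c)
coarsen M c B = <-rec _ step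
  where
  instance
    M*c≢0 : NonZero (M * c)
    M*c≢0 = m*n≢0 M c
  G g : ℕ → ℕ
  G m = partialSum B (m / c)
  g = stepSum M B
  step : ∀ n → (∀ {m} → m < n → stepSum (M * c) G m ≡ partialSum g (m / c)) →
         stepSum (M * c) G n ≡ partialSum g (n / c)
  step n rec with M * c ≤? n
  ... | yes Mc≤n = begin
    stepSum (M * c) G n                          ≡⟨ stepSum-≥ G Mc≤n ⟩
    G n + stepSum (M * c) G (n ∸ M * c)
      ≡⟨ cong (G n +_) (rec (∸-monoʳ-< (>-nonZero⁻¹ (M * c)) Mc≤n)) ⟩
    G n + partialSum g ((n ∸ M * c) / c)
      ≡⟨ cong (λ k → G n + partialSum g k) ([m∸n*o]/o≡m/o∸n n M c) ⟩
    partialSum B (n / c) + partialSum g (n / c ∸ M) ≡⟨ partialSum-stepSum B M≤n/c ⟨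
    partialSum g (n / c)                         ∎
    where
    open ≡-Reasoning
    M≤n/c : M ≤ n / c
    M≤n/c = subst (_≤ n / c) (m*n/n≡m M c) (/-monoˡ-≤ c Mc≤n)
  ... | no Mc≰n = trans (stepSum-< G n<Mc) (partialSum-cong (n / c) λ v≤n/c →
                    sym (stepSum-< {M} B (≤-<-trans v≤n/c (m<n*o⇒m/o<n n<Mc))))
    where
    n<Mc : n < M * c
    n<Mc = ≰⇒> Mc≰n

coarse-odd-step : ∀ {B} → B Preserves _≤_ ⟶ _≤_ → (∀ x → B (suc (x + x)) ≤ partialSum B x) →
  ∀ e .{{_ : NonZero e}} → 2 ≤ e → ∀ x → let C = λ n → partialSum B (n / e) in
  C (suc (suc x + suc x)) ≤ C (suc (x + x)) + C (suc x)
coarse-odd-step {B} B-mono B-odd e 2≤e x = begin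
  partialSum B u′                          ≤⟨ partialSum-≤-suc B u′≤1+u ⟩
  partialSum B u + B u′                    ≤⟨ +-monoʳ-≤ (partialSum B u) (B-mono u′≤1+z+z) ⟩
  partialSum B u + B (suc (z + z))         ≤⟨ +-monoʳ-≤ (partialSum B u) (B-odd z) ⟩
  partialSum B u + partialSum B z          ∎
  where
  open ≤-Reasoning
  u u′ z : ℕ
  u = suc (x + x) / e
  u′ = suc (suc x + suc x) / e
  z = suc x / e
  u′≤1+u : u′ ≤ suc u
  u′≤1+u = subst (λ k → suc (suc k) / e ≤ suc u) (sym (+-suc x x))
                 ([2+m]/n≤1+m/n (suc (x + x)) e 2≤e)
  u′≤1+z+z : u′ ≤ suc (z + z)
  u′≤1+z+z = [1+m+n]/o≤1+m/o+n/o (suc x) (suc x) e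

module _ {q : ℕ → ℕ} (q-mono : q Preserves _≤_ ⟶ _≤_) (q-pos : ∀ n → 1 ≤ q n)
         (2≤q3 : 2 ≤ q 3)
         (q-odd : ∀ {x} → 2 ≤ x → q (suc (x + x)) < partialSum q x) where

  private
    Q : ℕ → ℕ
    Q = partialSum q

  2+α≤partialSum : ∀ {α} → 3 ≤ α → 2 + α ≤ Q α
  2+α≤partialSum {3} (s≤s (s≤s (s≤s z≤n))) =
    +-mono-≤ (+-mono-≤ (+-mono-≤ (q-pos 0) (q-pos 1)) (q-pos 2)) 2≤q3
  2+α≤partialSum {suc (suc (suc (suc α)))} (s≤s (s≤s (s≤s z≤n))) =
    ≤-trans (s≤s (2+α≤partialSum {3 + α} (s≤s (s≤s (s≤s z≤n))))) (m<m+n _ (q-pos _))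

  partialSum-submult-≤ : ∀ {α β} → 3 ≤ α → α ≤ β → Q (suc (α + β)) < Q α * Q β
  partialSum-submult-≤ {α} {β} 3≤α α≤β = begin-strict
    Q (suc α + β)                   ≤⟨ partialSum-+-≤ q-mono (suc α) β ⟩
    Q β + suc α * q (suc α + β)     ≤⟨ +-monoʳ-≤ (Q β) (*-monoʳ-≤ (suc α) (q-mono 1+α+β≤1+β+β)) ⟩
    Q β + suc α * q (suc (β + β))   <⟨ +-monoʳ-< (Q β) (*-monoʳ-< (suc α) (q-odd 2≤β)) ⟩
    (2 + α) * Q β                   ≤⟨ *-monoˡ-≤ (Q β) (2+α≤partialSum 3≤α) ⟩
    Q α * Q β                       ∎
    where
    open ≤-Reasoning
    1+α+β≤1+β+β : suc (α + β) ≤ suc (β + β)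
    1+α+β≤1+β+β = s≤s (+-monoˡ-≤ β α≤β)
    2≤β : 2 ≤ β
    2≤β = ≤-trans (n≤1+n 2) (≤-trans 3≤α α≤β)

  partialSum-submult : ∀ {α β} → 3 ≤ α → 3 ≤ β → Q (suc (α + β)) < Q α * Q β
  partialSum-submult {α} {β} 3≤α 3≤β with ≤-total α β
  ... | inj₁ α≤β = partialSum-submult-≤ 3≤α α≤β
  ... | inj₂ β≤α = subst₂ _<_ (cong (Q ∘ suc) (+-comm β α)) (*-comm (Q β) (Q α))
                           (partialSum-submult-≤ 3≤β β≤α)

rising : ℕ → ℕ → ℕ
rising s zero    = 1
rising s (suc t) = rising (suc s) t * suc s

rising≢0 : ∀ s t → NonZero (rising s t)
rising≢0 s zero    = _
rising≢0 s (suc t) = m*n≢0 (rising (suc s) t) (suc s) {{rising≢0 (suc s) t}}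

rising-* : ∀ s t → rising s t * s ! ≡ (s + t) !
rising-* s zero = trans (*-identityˡ (s !)) (cong _! (sym (+-identityʳ s)))
rising-* s (suc t) = begin
  rising (suc s) t * suc s * s ! ≡⟨ *-assoc (rising (suc s) t) (suc s) (s !) ⟩
  rising (suc s) t * suc s !     ≡⟨ rising-* (suc s) t ⟩
  (suc s + t) !                  ≡⟨ cong _! (+-suc s t) ⟨
  (s + suc t) !                  ∎
  where open ≡-Reasoning

-- pFact s t n counts the partitions of n into the parts (s + i)! / s! with i < t:
-- besides its parts 1, such a partition is suc s times a partition counted by
-- pFact (suc s) t, of some v ≤ n / suc s.
pFact : ℕ → ℕ → ℕ → ℕ
pFact s zero    zero    = 1
pFact s zero    (suc n) = 0
pFact s (suc t) n       = partialSum (pFact (suc s) t) (n / suc s)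

pFact-zero : ∀ s t → pFact s t 0 ≡ 1
pFact-zero s zero    = refl
pFact-zero s (suc t) = pFact-zero (suc s) t

partialSum-pFact₀ : ∀ s m → partialSum (pFact s 0) m ≡ 1
partialSum-pFact₀ s zero    = refl
partialSum-pFact₀ s (suc m) = trans (+-identityʳ _) (partialSum-pFact₀ s m)

stepSum-1-pFact₀ : ∀ s n → stepSum 1 (pFact s 0) n ≡ 1
stepSum-1-pFact₀ s zero    = refl
stepSum-1-pFact₀ s (suc n) = stepSum-1-pFact₀ s n

pFact-suc : ∀ t s n → pFact s (suc t) n ≡ stepSum (rising s t) (pFact s t) n
pFact-suc zero    s n =
  trans (partialSum-pFact₀ (suc s) (n / suc s)) (sym (stepSum-1-pFact₀ s n))
pFact-suc (suc t) s n = begin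
  partialSum (pFact (suc s) (suc t)) (n / suc s)
    ≡⟨ partialSum-cong (n / suc s) (λ {v} _ → pFact-suc t (suc s) v) ⟩
  partialSum (stepSum (rising (suc s) t) (pFact (suc s) t)) (n / suc s)
    ≡⟨ coarsen (rising (suc s) t) (suc s) {{rising≢0 (suc s) t}} (pFact (suc s) t) n ⟨
  stepSum (rising s (suc t)) (pFact s (suc t)) n
    ∎
  where open ≡-Reasoning

P≡pFact : ∀ k n → P k n ≡ pFact 1 k n
P≡pFact zero    zero    = refl
P≡pFact zero    (suc n) = refl
P≡pFact (suc k) n = begin
  stepSum (suc k !) (P k) n          ≡⟨ sumSteps-cong _ (P≡pFact k) (suc n) n ⟩
  stepSum (suc k !) (pFact 1 k) n    ≡⟨ cong (λ d → stepSum d (pFact 1 k) n) rising-1 ⟨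
  stepSum (rising 1 k) (pFact 1 k) n ≡⟨ pFact-suc k 1 n ⟨
  pFact 1 (suc k) n                  ∎
  where
  open ≡-Reasoning
  rising-1 : rising 1 k ≡ suc k !
  rising-1 = trans (sym (*-identityʳ (rising 1 k))) (rising-* 1 k)

P-suc : ∀ {n k} → n ≤ k → P (suc k) n ≡ P k n
P-suc {n} {k} n≤k = stepSum-< (P k) (≤-<-trans n≤k (m≤m*n (suc k) (k !) {{k !≢0}}))

pN≡pFact : ∀ {n K} → n ≤ K → pN n ≡ pFact 1 K n
pN≡pFact {n} {K} n≤K = begin
  P n n             ≡⟨ P-stable (K ∸ n) ⟨
  P (K ∸ n + n) n   ≡⟨ cong (λ k → P k n) (m∸n+n≡m n≤K) ⟩
  P K n             ≡⟨ P≡pFact K n ⟩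
  pFact 1 K n       ∎
  where
  open ≡-Reasoning
  P-stable : ∀ j → P (j + n) n ≡ P n n
  P-stable zero    = refl
  P-stable (suc j) = trans (P-suc (m≤n+m n j)) (P-stable j)

pFact-mono : ∀ s t → pFact s (suc t) Preserves _≤_ ⟶ _≤_
pFact-mono s t = partialSum-mono (pFact (suc s) t) ∘ /-monoˡ-≤ (suc s)

pFact-pos : ∀ s t n → 1 ≤ pFact s (suc t) n
pFact-pos s t n =
  subst (_≤ pFact s (suc t) n) (pFact-zero s (suc t)) (pFact-mono s t {y = n} z≤n)

pFact-odd : ∀ t s x →
  pFact (suc s) (suc t) (suc (x + x)) ≤ partialSum (pFact (suc s) (suc t)) x
pFact-odd-step : ∀ t s x → let C = pFact (suc s) (suc (suc t)) in
  C (suc (suc x + suc x)) ≤ C (suc (x + x)) + C (suc x)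

pFact-odd-step t s =
  coarse-odd-step (pFact-mono (suc (suc s)) t) (pFact-odd t (suc s)) (suc (suc s)) (s≤s (s≤s z≤n))

pFact-odd zero s x = begin
  pFact (suc s) 1 (suc (x + x))  ≡⟨ partialSum-pFact₀ (suc (suc s)) (suc (x + x) / suc (suc s)) ⟩
  1                              ≤⟨ pFact-pos (suc s) 0 0 ⟩
  pFact (suc s) 1 0              ≤⟨ partialSum-mono (pFact (suc s) 1) {y = x} z≤n ⟩
  partialSum (pFact (suc s) 1) x ∎
  where open ≤-Reasoning
pFact-odd (suc t) s zero    = ≤-refl
pFact-odd (suc t) s (suc x) =
  ≤-trans (pFact-odd-step t s x) (+-monoˡ-≤ _ (pFact-odd (suc t) s x))

pFact₂-odd-< : ∀ t {x} → 2 ≤ x →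
  pFact 2 (2 + t) (suc (x + x)) < partialSum (pFact 2 (2 + t)) x
-- For x = 2 the two sides unfold to p + p and p + p + p, where p = pFact 4 t 0 = 1.
pFact₂-odd-< t {2} (s≤s (s≤s z≤n)) = m<m+n _ (≤-reflexive (sym (pFact-zero 4 t)))
pFact₂-odd-< t {suc (suc (suc x))} (s≤s (s≤s z≤n)) =
  ≤-<-trans (pFact-odd-step t 1 (2 + x)) (+-monoˡ-< _ (pFact₂-odd-< t {2 + x} (s≤s (s≤s z≤n))))

pFact₁-submult : ∀ t {a b} → 6 ≤ a → 6 ≤ b →
  pFact 1 (3 + t) (a + b) < pFact 1 (3 + t) a * pFact 1 (3 + t) b
pFact₁-submult t {a} {b} 6≤a 6≤b = begin-strict
  partialSum q ((a + b) / 2)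
    ≤⟨ partialSum-mono q (≤-trans (/-monoˡ-≤ 2 (n≤1+n (a + b))) ([1+m+n]/o≤1+m/o+n/o a b 2)) ⟩
  partialSum q (suc (a / 2 + b / 2))
    <⟨ partialSum-submult (pFact-mono 2 (suc t)) (pFact-pos 2 (suc t)) 2≤q3 (pFact₂-odd-< t)
                          (/-monoˡ-≤ 2 6≤a) (/-monoˡ-≤ 2 6≤b) ⟩
  partialSum q (a / 2) * partialSum q (b / 2)
    ∎
  where
  open ≤-Reasoning
  q : ℕ → ℕ
  q = pFact 2 (2 + t)
  2≤q3 : 2 ≤ q 3
  2≤q3 = ≤-reflexive (sym (cong₂ _+_ (pFact-zero 4 t) (pFact-zero 4 t)))

theorem6p3 : (a b : ℕ) → 6 ≤ a → 6 ≤ b → pN a * pN b > pN (a + b)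
theorem6p3 a b 6≤a 6≤b =
  subst₂ _<_ (sym (pN≡pFact a+b≤K)) (sym (cong₂ _*_ (pN≡pFact a≤K) (pN≡pFact b≤K)))
         (pFact₁-submult (a + b) 6≤a 6≤b)
  where
  K : ℕ
  K = 3 + (a + b)
  a+b≤K : a + b ≤ K
  a+b≤K = m≤n+m (a + b) 3
  a≤K : a ≤ K
  a≤K = ≤-trans (m≤m+n a b) a+b≤K
  b≤K : b ≤ K
  b≤K = ≤-trans (m≤n+m b a) a+b≤K
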